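{- Let $\mathcal{L}=(L_1,L_2,P,\&_1,\swarrow^1,\nwarrow_1,\dots,\&_n,\swarrow^n,\nwarrow_n)$ be a multi-adjoint frame and let $(X,Y,\phi)$ be a context of $\mathcal{L}$, i.e. sets $X$ (properties), $Y$ (objects), a map $\phi:X\times Y\to P$ and a map $|\cdot|:Y\to\{1,\dots,n\}$. Let $\phi_F:X\to\!\!\!\!\circ\; Y$ be the $\mathcal{Q}_F^{\mathcal{L}}$-relation with $|x|=-1$ for $x\in X$, the given types $|y|$ for $y\in Y$, and $\phi_F(x,y)=\phi(x,y)\in\mathcal{Q}_F^{\mathcal{L}}(-1,|y|)=P$. Then the multi-adjoint concept lattice of $(X,Y,\phi)$ is isomorphic, as a complete lattice, to the $0$-fibre $(\mathcal{M}\phi_F)_0$ of the complete $\mathcal{Q}_F^{\mathcal{L}}$-category $\mathcal{M}\phi_F$ of fixed points of the Isbell adjunction induced by $\phi_F$.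
   Context: Multi-adjoint frame: complete lattices $L_1,L_2,P$ and for $i=1,\dots,n$ maps $\&_i:L_1\times L_2\to P$, $\swarrow^i:P\times L_2\to L_1$, $\nwarrow_i:P\times L_1\to L_2$ with $x\,\&_i\,y\le z\iff x\le z\swarrow^i y\iff y\le z\nwarrow_i x$. Quantaloid $\mathcal{Q}_F^{\mathcal{L}}$: objects $-1,0,1,\dots,n$; $\mathcal{Q}_F^{\mathcal{L}}(-1,0)=L_1$, $\mathcal{Q}_F^{\mathcal{L}}(0,i)=L_2$, $\mathcal{Q}_F^{\mathcal{L}}(-1,i)=P$ ($1\le i\le n$); $\mathcal{Q}_F^{\mathcal{L}}(i,i)=\{\bot_{i,i}<\mathrm{id}_i\}$; all other hom-sets are one-element; composition $v\circ u=u\,\&_i\,v$ for $u\in L_1=\mathcal{Q}_F^{\mathcal{L}}(-1,0)$, $v\in L_2=\mathcal{Q}_F^{\mathcal{L}}(0,i)$, identities act as identities, other composites are bottom. Its left/right implications (defined by $v\circ u\le w\iff v\le w/u\iff u\le v\backslash w$) are $w/u=w\nwarrow_i u$ and $v\backslash w=w\swarrow^i v$ for $u\in L_1$, $v\in L_2$, $w\in P=\mathcal{Q}_F^{\mathcal{L}}(-1,i)$. For a quantaloid $\mathcal{Q}$ and sets $X,Y$ typed by maps into the objects of $\mathcal{Q}$, a $\mathcal{Q}$-relation $\phi:X\to\!\!\!\!\circ\; Y$ assigns $\phi(x,y)\in\mathcal{Q}(|x|,|y|)$. Regarding $X,Y$ as discrete $\mathcal{Q}$-categories, a presheaf of type $q$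 on $X$ is a map $\mu$ with $\mu(x)\in\mathcal{Q}(|x|,q)$, and a copresheaf of type $q$ on $Y$ is a map $\lambda$ with $\lambda(y)\in\mathcal{Q}(q,|y|)$. The presheaf $\mathcal{Q}$-category $\mathcal{P}X$ has hom $\bigwedge_x\mu'(x)/\mu(x)$; its underlying order on presheaves of a fixed type is the pointwise order. The Isbell adjunction sends a presheaf $\mu$ of type $q$ to the copresheaf $(\phi_\uparrow\mu)(y)=\bigwedge_{x\in X}\phi(x,y)/\mu(x)$ and a copresheaf $\lambda$ of type $q$ to the presheaf $(\phi^\downarrow\lambda)(x)=\bigwedge_{y\in Y}\lambda(y)\backslash\phi(x,y)$. $\mathcal{M}\phi=\{\mu\in\mathcal{P}X\mid\phi^\downarrow\phi_\uparrow\mu=\mu\}$ with the $\mathcal{Q}$-category structure inherited from $\mathcal{P}X$, and its $q$-fibre $(\mathcal{M}\phi)_q$ is the set of its elements of type $q$ with the underlying (pointwise) order. Concretely, $(\mathcal{M}\phi_F)_0=\{\mu\in L_1^X\mid\mu=\mu^{\uparrow\downarrow}\}$ ordered pointwise, where for $\mu\in L_1^X$, $\lambda\in L_2^Y$: $\mu^\uparrow(y)=\bigwedge_{x\in X}\phi(x,y)\nwarrow_{|y|}\mu(x)$ and $\lambda^\downarrow(x)=\bigwedge_{y\in Y}\phi(x,y)\swarrow^{|y|}\lambda(y)$. The multi-adjoint concept lattice of $(X,Y,\phi)$ is the complete lattice of fixed points of this Galois connection $\uparrow:L_1^X\rightleftarrows L_2^Y:\downarrow$, i.e. the set of pairs $(\lambda,\mu)\in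 L_2^Y\times L_1^X$ with $\mu^\uparrow=\lambda$ and $\lambda^\downarrow=\mu$, ordered by $(\lambda_1,\mu_1)\le(\lambda_2,\mu_2)$ iff $\mu_1\le\mu_2$ pointwise (equivalently $\lambda_2\le\lambda_1$ pointwise). -}

module Defs where

open import Data.Nat using (ℕ)
open import Data.Fin using (Fin)
open import Relation.Binary.PropositionalEquality using (_≡_)
open import Relation.Binary.Structures using (IsPartialOrder)
open import Function.Bundles using (_⇔_)

record CompleteLattice : Set₁ where
  field
    Carrier        : Set
    _≤_            : Carrier → Carrier → Set
    isPartialOrder : IsPartialOrder _≡_ _≤_
    ⋀              : {I : Set} → (I → Carrier) → Carrier
    ⋀-lower        : ∀ {I} (f : I → Carrier) (i : I) → ⋀ f ≤ f i
    ⋀-greatest     : ∀ {I} (f : I → Carrier) (z : Carrier) →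
                     (∀ i → z ≤ f i) → z ≤ ⋀ f
    ⋁              : {I : Set} → (I → Carrier) → Carrier
    ⋁-upper        : ∀ {I} (f : I → Carrier) (i : I) → f i ≤ ⋁ f
    ⋁-least        : ∀ {I} (f : I → Carrier) (z : Carrier) →
                     (∀ i → f i ≤ z) → ⋁ f ≤ z

open CompleteLattice using (Carrier)

record MultiAdjointFrame (n : ℕ) : Set₁ where
  field
    L₁ L₂ P : CompleteLattice
    conj  : Fin n → Carrier L₁ → Carrier L₂ → Carrier P
    impl₁ : Fin n → Carrier P → Carrier L₂ → Carrier L₁   -- z ↙ⁱ y
    impl₂ : Fin n → Carrier P → Carrier L₁ → Carrier L₂   -- z ↖ᵢ x
    adj₁  : ∀ i x y z →
            CompleteLattice._≤_ P (conj i x y) z ⇔ CompleteLattice._≤_ L₁ x (impl₁ i z y)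
    adj₂  : ∀ i x y z →
            CompleteLattice._≤_ L₁ x (impl₁ i z y) ⇔ CompleteLattice._≤_ L₂ y (impl₂ i z x)

record Context {n : ℕ} (𝓛 : MultiAdjointFrame n) : Set₁ where
  field
    X    : Set
    Y    : Set
    φ    : X → Y → Carrier (MultiAdjointFrame.P 𝓛)
    type : Y → Fin n

-- Order isomorphisms between posets given by a carrier, an equality and
-- an order.  (An order isomorphism between complete lattices is a
-- complete-lattice isomorphism.)

record OrderIso (A : Set) (_≈A_ : A → A → Set) (_≤A_ : A → A → Set)
                (B : Set) (_≈B_ : B → B → Set) (_≤B_ : B → B → Set) : Set where
  field
    to       : A → B
    from     : B → A
    from∘to  : ∀ a → from (to a) ≈A a
    to∘from  : ∀ b → to (from b) ≈B b
    to-≤     : ∀ a a' → (a ≤A a') ⇔ (to a ≤B to a')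

module _ {n : ℕ} (𝓛 : MultiAdjointFrame n) (K : Context 𝓛) where
  open MultiAdjointFrame 𝓛
  open Context K
  private
    module L₁ = CompleteLattice L₁
    module L₂ = CompleteLattice L₂
    module P  = CompleteLattice P

  _↑ : (X → L₁.Carrier) → (Y → L₂.Carrier)
  (μ ↑) y = L₂.⋀ (λ x → impl₂ (type y) (φ x y) (μ x))

  _↓ : (Y → L₂.Carrier) → (X → L₁.Carrier)
  (λ' ↓) x = L₁.⋀ (λ y → impl₁ (type y) (φ x y) (λ' y))

  record Concept : Set where
    field
      ext  : Y → L₂.Carrier
      int  : X → L₁.Carrier
      ↑-eq : ∀ y → (int ↑) y ≡ ext y
      ↓-eq : ∀ x → (ext ↓) x ≡ int x

  _≈C_ : Concept → Concept → Set
  c ≈C d = (∀ y → Concept.ext c y ≡ Concept.ext d y) ×' (∀ x → Concept.int c x ≡ Concept.int d x)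
    where open import Data.Product using () renaming (_×_ to _×'_)

  _≤C_ : Concept → Concept → Set
  c ≤C d = ∀ x → Concept.int c x L₁.≤ Concept.int d x

  -- The quantaloid Q_F^𝓛 on the relevant hom-sets:
  --   Q(-1,0) = L₁, Q(0,i) = L₂, Q(-1,i) = P  (1 ≤ i ≤ n),
  -- with implications  w / u = w ↖ᵢ u  and  v \ w = w ↙ⁱ v
  -- (u ∈ Q(-1,0), v ∈ Q(0,i), w ∈ Q(-1,i)).
  Q[-1,0] : Set
  Q[-1,0] = L₁.Carrier

  Q[0,_] : Fin n → Set
  Q[0, i ] = L₂.Carrier

  Q[-1,_] : Fin n → Set
  Q[-1, i ] = P.Carrier

  right-impl : (i : Fin n) → Q[-1, i ] → Q[-1,0] → Q[0, i ]
  right-impl i w u = impl₂ i w u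

  left-impl : (i : Fin n) → Q[0, i ] → Q[-1, i ] → Q[-1,0]
  left-impl i v w = impl₁ i w v

  φF : (x : X) (y : Y) → Q[-1, type y ]
  φF = φ

  Presheaf₀ : Set
  Presheaf₀ = X → Q[-1,0]

  Copresheaf₀ : Set
  Copresheaf₀ = (y : Y) → Q[0, type y ]

  isbell↑ : Presheaf₀ → Copresheaf₀
  isbell↑ μ y = L₂.⋀ (λ x → right-impl (type y) (φF x y) (μ x))

  isbell↓ : Copresheaf₀ → Presheaf₀
  isbell↓ λ' x = L₁.⋀ (λ y → left-impl (type y) (λ' y) (φF x y))

  record Fibre₀ : Set where
    field
      pre   : Presheaf₀
      fixed : ∀ x → isbell↓ (isbell↑ pre) x ≡ pre x

  _≈F_ : Fibre₀ → Fibre₀ → Set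
  a ≈F b = ∀ x → Fibre₀.pre a x ≡ Fibre₀.pre b x

  _≤F_ : Fibre₀ → Fibre₀ → Set
  a ≤F b = ∀ x → Fibre₀.pre a x L₁.≤ Fibre₀.pre b x

{-# OPTIONS --safe #-}
module Submission where

-- On presheaves of type 0 the Isbell adjunction of φ_F is, hom-set by
-- hom-set, the multi-adjoint Galois connection: w / u = w ↖ᵢ u and
-- v \ w = w ↙ⁱ v, so isbell↑ = ↑ and isbell↓ = ↓ definitionally.  A
-- concept is determined by its intent μ, which is a fixed point of ↓↑;
-- conversely a fixed point μ yields the concept (μ↑ , μ).  Both orders
-- compare intents pointwise.

open import Data.Nat using (ℕ)
open import Data.Product using (_,_)
open import Function.Base using (id; _∘_)
open import Function.Bundles using (mk⇔)
open import Relation.Binary.PropositionalEquality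
  using (_≡_; refl; sym; cong; module ≡-Reasoning)
open import Relation.Binary.Structures using (IsPartialOrder)
open import Defs

module _ (L : CompleteLattice) where
  open CompleteLattice L
  open IsPartialOrder isPartialOrder using (antisym; reflexive; trans)

  ⋀-mono : ∀ {I} {f g : I → Carrier} → (∀ i → f i ≤ g i) → ⋀ f ≤ ⋀ g
  ⋀-mono {f = f} {g} f≤g = ⋀-greatest g (⋀ f) (λ i → trans (⋀-lower f i) (f≤g i))

  ⋀-cong : ∀ {I} {f g : I → Carrier} → (∀ i → f i ≡ g i) → ⋀ f ≡ ⋀ g
  ⋀-cong f≗g = antisym (⋀-mono (reflexive ∘ f≗g)) (⋀-mono (reflexive ∘ sym ∘ f≗g))

module _ {n : ℕ} (𝓛 : MultiAdjointFrame n) (K : Context 𝓛) where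
  open MultiAdjointFrame 𝓛
  open Context K
  open Concept

  intent-↓↑-closed : (c : Concept 𝓛 K) → ∀ x → _↓ 𝓛 K (_↑ 𝓛 K (int c)) x ≡ int c x
  intent-↓↑-closed c x = begin
    _↓ 𝓛 K (_↑ 𝓛 K (int c)) x ≡⟨ ⋀-cong L₁ (λ y → cong (impl₁ (type y) (φ x y)) (↑-eq c y)) ⟩
    _↓ 𝓛 K (ext c) x           ≡⟨ ↓-eq c x ⟩
    int c x                    ∎
    where open ≡-Reasoning

  concept→fibre₀ : Concept 𝓛 K → Fibre₀ 𝓛 K
  concept→fibre₀ c = record { pre = int c ; fixed = intent-↓↑-closed c }

  fibre₀→concept : Fibre₀ 𝓛 K → Concept 𝓛 K
  fibre₀→concept a = record
    { ext  = _↑ 𝓛 K (Fibre₀.pre a)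
    ; int  = Fibre₀.pre a
    ; ↑-eq = λ _ → refl
    ; ↓-eq = Fibre₀.fixed a
    }

theorem4p2 : {n : ℕ} (𝓛 : MultiAdjointFrame n) (K : Context 𝓛) →
    OrderIso (Concept 𝓛 K) (_≈C_ 𝓛 K) (_≤C_ 𝓛 K)
             (Fibre₀ 𝓛 K) (_≈F_ 𝓛 K) (_≤F_ 𝓛 K)
theorem4p2 𝓛 K = record
  { to      = concept→fibre₀ 𝓛 K
  ; from    = fibre₀→concept 𝓛 K
  ; from∘to = λ c → Concept.↑-eq c , λ _ → refl
  ; to∘from = λ _ _ → refl
  ; to-≤    = λ _ _ → mk⇔ id id
  }
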